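{- Let $\mathcal{C}\subseteq\mathcal{T}$ be a subcategory and $\sim$ a congruence relation on $\mathcal{C}$, and assume Axiom 1 ($\mathcal{C}$ contains every morphism of $\mathcal{T}$ that is an injective induced graph map), Axiom 3 (for every AN $G$, every triad of $G$ and every ordered triple $(i,j,k)$ of its distinct actors, there is at most one wedge at $(i,j,k)$) and Axiom 4 (for every AN $G$, if a triad of $G$ has wedges at two ordered triples with different centers, then both are closed). Then each triad of any AN has exactly one of the following: no wedges, exactly two wedges which are both open, or six closed wedges (one at each of its six ordered triples).
   Context: An affiliation network (AN) is a finite simple undirected bipartite graph whose nodes are actors and events, each edge joining an actor to an event. A graph map sends nodes to nodes and edges to edges; it is injective if injective on nodes and induced if its image is an induced subgraph of the target. For a set $S$ of actors of $G$, the subgraph scheduled by $S$ is induced by $S$ together with all events attended by at least two actors of $S$; a triad of $G$ is the subgraph scheduled by three actors. $\mathcal{T}$: objects are triads (ANs with three actors, each event attended by at least two), morphisms $H\to K$ are graph maps sending actors of $H$ to distinct actors of $K$ and events to events. A congruence relation is a family of equivalence relations on hom-sets compatible with composition. Fixed: $W$ = path $v_0v_1v_2v_3v_4$ (actors $v_0,v_2,v_4$; events $v_1,v_3$), $X$ = 6-cycle $v_0v_1\cdots v_5v_0$ (actors $v_0,v_2,v_4$; events $v_1,v_3,v_5$), $\iota:W\to X$, $\iota(v_i)=v_i$. For an AN $G$, $\mathsf{Hom}_{\mathcal{C}/\sim}(H,G)$ is the set of $\sim$-classes of morphisms in $\mathcal{C}$ from $H$ into triads of $G$. Wedges are elements of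 $\mathsf{Hom}_{\mathcal{C}/\sim}(W,G)$; a wedge $\phi$ is closed if $\phi\sim\psi\circ\iota$ for some morphism $\psi$ in $\mathcal{C}$ from $X$ into a triad of $G$, open otherwise; alcoves are elements of $\mathsf{Hom}_{\mathcal{C}/\sim}(X,G)$. A wedge is at the ordered triple $(i,j,k)$ if it sends $v_0,v_2,v_4$ to $i,j,k$; its center is $j$. A triad has a wedge if the wedge maps into that triad. -}

module Defs where

open import Data.Nat using (ℕ)
open import Data.Bool using (Bool; true; false; _∧_; _∨_; T)
open import Data.Unit using (tt)
open import Data.Fin using (Fin; zero; suc; _<_)
open import Data.Product using (Σ; ∃; _×_; _,_; proj₁; proj₂)
open import Data.Sum using (_⊎_)
open import Data.Empty using (⊥)
open import Relation.Nullary using (¬_)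
open import Relation.Binary.PropositionalEquality using (_≡_; _≢_; refl)
open import Function.Definitions using (Injective)

-- Affiliation networks (finite, simple, bipartite).
-- Actors are Fin na, events are Fin ne; att a e = true iff there is an
-- edge between actor a and event e.

record AN : Set where
  field
    na ne : ℕ
    att : Fin na → Fin ne → Bool

two : Bool → Bool → Bool → Bool
two x y z = (x ∧ y) ∨ (y ∧ z) ∨ (x ∧ z)

record Triad : Set₁ where
  field
    Event  : Set
    finite : Σ ℕ λ n → Σ (Event → Fin n) λ f → Injective _≡_ _≡_ f
    att    : Fin 3 → Event → Bool
    twoAtt : ∀ e → T (two (att zero e) (att (suc zero) e) (att (suc (suc zero)) e))
open Triad

record Hom (H K : Triad) : Set where
  field
    act  : Fin 3 → Fin 3
    ev   : Event H → Event K
    pres : ∀ a e → T (att H a e) → T (att K (act a) (ev e))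
open Hom

IsTMor : ∀ {H K} → Hom H K → Set
IsTMor f = Injective _≡_ _≡_ (act f)

InjInduced : ∀ {H K} → Hom H K → Set
InjInduced {H} {K} f =
  Injective _≡_ _≡_ (act f) × Injective _≡_ _≡_ (ev f) ×
  (∀ a e → T (att K (act f a) (ev f e)) → T (att H a e))

idH : ∀ H → Hom H H
idH H = record { act = λ a → a ; ev = λ e → e ; pres = λ a e p → p }

_∘H_ : ∀ {H K L} → Hom K L → Hom H K → Hom H L
g ∘H f = record
  { act  = λ a → act g (act f a)
  ; ev   = λ e → ev g (ev f e)
  ; pres = λ a e p → pres g (act f a) (ev f e) (pres f a e p) }

MorPred : Set₁
MorPred = ∀ {H K : Triad} → Hom H K → Set

MorRel : Set₁
MorRel = ∀ {H K : Triad} → Hom H K → Hom H K → Set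

record IsSubcategory (𝒞 : MorPred) : Set₁ where
  field
    inT   : ∀ {H K} (f : Hom H K) → 𝒞 f → IsTMor f
    idC   : ∀ H → 𝒞 (idH H)
    compC : ∀ {H K L} (g : Hom K L) (f : Hom H K) → 𝒞 g → 𝒞 f → 𝒞 (g ∘H f)

record IsCongruence (𝒞 : MorPred) (_∼_ : MorRel) : Set₁ where
  field
    reflC  : ∀ {H K} (f : Hom H K) → 𝒞 f → f ∼ f
    symC   : ∀ {H K} (f g : Hom H K) → 𝒞 f → 𝒞 g → f ∼ g → g ∼ f
    transC : ∀ {H K} (f g h : Hom H K) → 𝒞 f → 𝒞 g → 𝒞 h →
             f ∼ g → g ∼ h → f ∼ h
    compatC : ∀ {H K L} (f f' : Hom H K) (g g' : Hom K L) →
              𝒞 f → 𝒞 f' → 𝒞 g → 𝒞 g' →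
              f ∼ f' → g ∼ g' → (g ∘H f) ∼ (g' ∘H f')

-- Triads of an AN G: the subgraph scheduled by three actors a < b < c
-- (actor 0,1,2 of the triad object are a,b,c; events are the events of G
-- attended by at least two of a,b,c).

record TriadIn (G : AN) : Set where
  field
    a b c : Fin (AN.na G)
    a<b : a < b
    b<c : b < c

T-irr : ∀ b (p q : T b) → p ≡ q
T-irr true p q = refl

proj₁-inj : ∀ {n} (P : Fin n → Bool) →
  Injective _≡_ _≡_ (proj₁ {B = λ e → T (P e)})
proj₁-inj P {e , p} {.e , q} refl with T-irr (P e) p q
... | refl = refl

module _ (G : AN) (τ : TriadIn G) where
  open TriadIn τ
  pick : Fin 3 → Fin (AN.na G)
  pick zero = a
  pick (suc zero) = b
  pick (suc (suc zero)) = c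

  SchedEv : Fin (AN.ne G) → Bool
  SchedEv e = two (AN.att G a e) (AN.att G b e) (AN.att G c e)

  triad : Triad
  triad = record
    { Event  = Σ (Fin (AN.ne G)) λ e → T (SchedEv e)
    ; finite = AN.ne G , proj₁ , proj₁-inj SchedEv
    ; att    = λ k e → AN.att G (pick k) (proj₁ e)
    ; twoAtt = λ e → proj₂ e }

-- The fixed triads W (path v0 v1 v2 v3 v4) and X (6-cycle v0 … v5 v0).
-- Actors v0,v2,v4 are 0,1,2; events of W: v1 = 0, v3 = 1;
-- events of X: v1 = 0, v3 = 1, v5 = 2.

attW : Fin 3 → Fin 2 → Bool
attW zero zero = true
attW zero (suc zero) = false
attW (suc zero) zero = true
attW (suc zero) (suc zero) = true
attW (suc (suc zero)) zero = false
attW (suc (suc zero)) (suc zero) = true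

attX : Fin 3 → Fin 3 → Bool
attX zero zero = true
attX zero (suc zero) = false
attX zero (suc (suc zero)) = true
attX (suc zero) zero = true
attX (suc zero) (suc zero) = true
attX (suc zero) (suc (suc zero)) = false
attX (suc (suc zero)) zero = false
attX (suc (suc zero)) (suc zero) = true
attX (suc (suc zero)) (suc (suc zero)) = true

twoW : ∀ e → T (two (attW zero e) (attW (suc zero) e) (attW (suc (suc zero)) e))
twoW zero = tt
twoW (suc zero) = tt

twoX : ∀ e → T (two (attX zero e) (attX (suc zero) e) (attX (suc (suc zero)) e))
twoX zero = tt
twoX (suc zero) = tt
twoX (suc (suc zero)) = tt

W : Triad
W = record { Event = Fin 2 ; finite = 2 , (λ e → e) , (λ p → p) ; att = attW ; twoAtt = twoW }

X : Triad
X = record { Event = Fin 3 ; finite = 3 , (λ e → e) , (λ p → p) ; att = attX ; twoAtt = twoX }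

ιev : Fin 2 → Fin 3
ιev zero = zero
ιev (suc zero) = suc zero

ιpres : ∀ a e → T (attW a e) → T (attX a (ιev e))
ιpres zero zero p = p
ιpres zero (suc zero) ()
ιpres (suc (suc zero)) zero ()
ιpres (suc zero) zero p = p
ιpres (suc zero) (suc zero) p = p
ιpres (suc (suc zero)) (suc zero) p = p

ι : Hom W X
ι = record { act = λ a → a ; ev = ιev ; pres = ιpres }

triple : ∀ {T'} → Hom W T' → Fin 3 × Fin 3 × Fin 3
triple φ = act φ zero , act φ (suc zero) , act φ (suc (suc zero))

center : ∀ {T'} → Hom W T' → Fin 3
center φ = act φ (suc zero)

Closed : MorPred → MorRel → ∀ {T'} → Hom W T' → Set
Closed 𝒞 _∼_ {T'} φ = Σ (Hom X T') λ ψ → 𝒞 ψ × (φ ∼ (ψ ∘H ι))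

SameWedge : MorRel → ∀ {T'} → Hom W T' → Hom W T' → Set
SameWedge _∼_ φ ψ = (φ ∼ ψ) × (triple φ ≡ triple ψ)

Distinct3 : Fin 3 → Fin 3 → Fin 3 → Set
Distinct3 i j k = (i ≢ j) × (j ≢ k) × (i ≢ k)

Axiom1 : MorPred → Set₁
Axiom1 𝒞 = ∀ {H K} (f : Hom H K) → IsTMor f → InjInduced f → 𝒞 f

Axiom3 : MorPred → MorRel → Set
Axiom3 𝒞 _∼_ = ∀ (G : AN) (τ : TriadIn G) (φ ψ : Hom W (triad G τ)) →
  𝒞 φ → 𝒞 ψ → triple φ ≡ triple ψ → φ ∼ ψ

Axiom4 : MorPred → MorRel → Set
Axiom4 𝒞 _∼_ = ∀ (G : AN) (τ : TriadIn G) (φ ψ : Hom W (triad G τ)) →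
  𝒞 φ → 𝒞 ψ → center φ ≢ center ψ → Closed 𝒞 _∼_ φ × Closed 𝒞 _∼_ ψ

NoWedges : MorPred → Triad → Set
NoWedges 𝒞 T' = ∀ (φ : Hom W T') → ¬ 𝒞 φ

TwoOpenWedges : MorPred → MorRel → Triad → Set
TwoOpenWedges 𝒞 _∼_ T' = Σ (Hom W T') λ φ₁ → Σ (Hom W T') λ φ₂ →
  𝒞 φ₁ × 𝒞 φ₂ × ¬ SameWedge _∼_ φ₁ φ₂ ×
  ((φ : Hom W T') → 𝒞 φ → SameWedge _∼_ φ φ₁ ⊎ SameWedge _∼_ φ φ₂) ×
  ¬ Closed 𝒞 _∼_ φ₁ × ¬ Closed 𝒞 _∼_ φ₂

SixClosedWedges : MorPred → MorRel → Triad → Set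
SixClosedWedges 𝒞 _∼_ T' =
  ((i j k : Fin 3) → Distinct3 i j k →
     Σ (Hom W T') λ φ → 𝒞 φ × triple φ ≡ (i , j , k)) ×
  ((φ ψ : Hom W T') → 𝒞 φ → 𝒞 ψ → triple φ ≡ triple ψ → SameWedge _∼_ φ ψ) ×
  ((φ : Hom W T') → 𝒞 φ → Closed 𝒞 _∼_ φ)

ExactlyOneOf : Set → Set → Set → Set
ExactlyOneOf A B C =
  (A ⊎ B ⊎ C) × ¬ (A × B) × ¬ (A × C) × ¬ (B × C)

-- The actor map of an alcove ψ : X → T is a bijection of the three actors, and X
-- contains an induced copy of W at each of its six ordered triples, so by Axiom 1 a
-- closed wedge forces a wedge at every ordered triple. If two wedges of T have
-- different centers, Axiom 4 makes every wedge closed, and we get six closed wedges,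
-- one per triple by Axiom 3. Otherwise all wedges share the center b of some wedge
-- at (a, b, c), so they sit at (a, b, c) or at (c, b, a), the latter being reached by
-- reversing W; none of them is closed, as that would give a wedge centered at a.
module Submission where

open import Level using (0ℓ)
open import Axiom.ExcludedMiddle using (ExcludedMiddle)
open import Defs

open import Data.Bool using (T)
open import Data.Fin using (Fin; zero; suc; _≟_; opposite; punchOut)
open import Data.Fin.Properties
  using (any?; punchOut-injective; injective⇒≤; opposite-involutive)
open import Data.Nat using (suc)
open import Data.Nat.Properties using (1+n≰n)
open import Data.Product using (Σ; ∃; _×_; _,_; proj₁; proj₂)
open import Data.Sum using (_⊎_; inj₁; inj₂)
import Data.Sum as Sum
open import Data.Unit using (tt)
open import Data.Vec using ([]; _∷_; lookup)
open import Function using (_∘_)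
open import Function.Definitions using (Injective)
open import Function.Consequences.Propositional
  using (inverseʳ⇒injective; strictlyInverseʳ⇒inverseʳ)
open import Relation.Nullary using (¬_; yes; no; contradiction)
open import Relation.Nullary.Decidable using (decidable-stable)
open import Relation.Binary.PropositionalEquality
  using (_≡_; _≢_; refl; sym; trans; cong; cong₂; subst)

open Hom

pattern 0F = zero
pattern 1F = suc zero
pattern 2F = suc (suc zero)

injective⇒surjective : ∀ {n} {f : Fin n → Fin n} → Injective _≡_ _≡_ f →
                       ∀ y → ∃ λ x → f x ≡ y
injective⇒surjective {suc n} {f} f-inj y with any? (λ x → f x ≟ y)
... | yes hit  = hit
... | no  miss = contradiction (injective⇒≤ punchedOut-injective) 1+n≰n
  where
  -- if y is missed, punching it out of the range injects Fin (suc n) into Fin n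
  y≢f : ∀ x → y ≢ f x
  y≢f x = miss ∘ (x ,_) ∘ sym

  punchedOut-injective : Injective _≡_ _≡_ (λ x → punchOut (y≢f x))
  punchedOut-injective = f-inj ∘ punchOut-injective (y≢f _) (y≢f _)

injection-factors-through-injection :
  ∀ {n} {g ρ : Fin n → Fin n} → Injective _≡_ _≡_ g → Injective _≡_ _≡_ ρ →
  ∃ λ σ → Injective _≡_ _≡_ σ × (∀ x → g (σ x) ≡ ρ x)
injection-factors-through-injection {n} {g} {ρ} g-inj ρ-inj =
  σ , σ-inj , proj₂ ∘ preimage
  where
  preimage : ∀ x → ∃ λ y → g y ≡ ρ x
  preimage x = injective⇒surjective g-inj (ρ x)

  σ : Fin n → Fin n
  σ = proj₁ ∘ preimage

  σ-inj : Injective _≡_ _≡_ σ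
  σ-inj {x} {y} σx≡σy =
    ρ-inj (trans (sym (proj₂ (preimage x)))
                 (trans (cong g σx≡σy) (proj₂ (preimage y))))

injective⇒distinct : ∀ {f : Fin 3 → Fin 3} → Injective _≡_ _≡_ f →
                     Distinct3 (f 0F) (f 1F) (f 2F)
injective⇒distinct f-inj = (λ ()) ∘ f-inj , (λ ()) ∘ f-inj , (λ ()) ∘ f-inj

distinct⇒injective : ∀ {a b c : Fin 3} → Distinct3 a b c →
                     Injective _≡_ _≡_ (lookup (a ∷ b ∷ c ∷ []))
distinct⇒injective _               {0F} {0F} _ = refl
distinct⇒injective (a≢b , _ , _)   {0F} {1F} e = contradiction e a≢b
distinct⇒injective (_ , _ , a≢c)   {0F} {2F} e = contradiction e a≢c
distinct⇒injective (a≢b , _ , _)   {1F} {0F} e = contradiction (sym e) a≢b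
distinct⇒injective _               {1F} {1F} _ = refl
distinct⇒injective (_ , b≢c , _)   {1F} {2F} e = contradiction e b≢c
distinct⇒injective (_ , _ , a≢c)   {2F} {0F} e = contradiction (sym e) a≢c
distinct⇒injective (_ , b≢c , _)   {2F} {1F} e = contradiction (sym e) b≢c
distinct⇒injective _               {2F} {2F} _ = refl

≢middle⇒end : ∀ {a b c x : Fin 3} → Distinct3 a b c → x ≢ b → x ≡ a ⊎ x ≡ c
≢middle⇒end {x = x} d x≢b with injective⇒surjective (distinct⇒injective d) x
... | 0F , a≡x = inj₁ (sym a≡x)
... | 1F , b≡x = contradiction (sym b≡x) x≢b
... | 2F , c≡x = inj₂ (sym c≡x)

same-center⇒same-or-reversed :
  ∀ {a b c x y z : Fin 3} → Distinct3 a b c → Distinct3 x y z → y ≡ b →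
  (x , y , z) ≡ (a , b , c) ⊎ (x , y , z) ≡ (c , b , a)
same-center⇒same-or-reversed d (x≢b , b≢z , x≢z) refl
  with ≢middle⇒end d x≢b | ≢middle⇒end d (b≢z ∘ sym)
... | inj₁ refl | inj₁ refl = contradiction refl x≢z
... | inj₁ refl | inj₂ refl = inj₁ refl
... | inj₂ refl | inj₁ refl = inj₂ refl
... | inj₂ refl | inj₂ refl = contradiction refl x≢z

-- Each event of X is attended by exactly two of the three actors, hence determined
-- by the actor it omits.
eventOmitting : Fin 3 → Fin 3
eventOmitting 0F = 1F
eventOmitting 1F = 2F
eventOmitting 2F = 0F

attX-eventOmitting : ∀ {x y} → x ≢ y → T (attX x (eventOmitting y))
attX-eventOmitting {0F} {0F} x≢x = contradiction refl x≢x
attX-eventOmitting {1F} {1F} x≢x = contradiction refl x≢x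
attX-eventOmitting {2F} {2F} x≢x = contradiction refl x≢x
attX-eventOmitting {0F} {1F} _ = tt
attX-eventOmitting {0F} {2F} _ = tt
attX-eventOmitting {1F} {0F} _ = tt
attX-eventOmitting {1F} {2F} _ = tt
attX-eventOmitting {2F} {0F} _ = tt
attX-eventOmitting {2F} {1F} _ = tt

¬attX-eventOmitting-self : ∀ x → ¬ T (attX x (eventOmitting x))
¬attX-eventOmitting-self 0F ()
¬attX-eventOmitting-self 1F ()
¬attX-eventOmitting-self 2F ()

eventOmitting-injective : Injective _≡_ _≡_ eventOmitting
eventOmitting-injective {x} {y} e = decidable-stable (x ≟ y) λ x≢y →
  ¬attX-eventOmitting-self x (subst (T ∘ attX x) (sym e) (attX-eventOmitting x≢y))

-- v₁ joins v₀ and v₂, so it goes to the event omitting the image of v₄; dually for v₃.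
wedgeEvents : (Fin 3 → Fin 3) → Fin 2 → Fin 3
wedgeEvents σ 0F = eventOmitting (σ 2F)
wedgeEvents σ 1F = eventOmitting (σ 0F)

wedgeInX : (σ : Fin 3 → Fin 3) → Injective _≡_ _≡_ σ → Hom W X
wedgeInX σ σ-inj = record { act = σ ; ev = wedgeEvents σ ; pres = preserves }
  where
  preserves : ∀ a e → T (attW a e) → T (attX (σ a) (wedgeEvents σ e))
  preserves 0F 0F _ = attX-eventOmitting ((λ ()) ∘ σ-inj)
  preserves 0F 1F ()
  preserves 1F 0F _ = attX-eventOmitting ((λ ()) ∘ σ-inj)
  preserves 1F 1F _ = attX-eventOmitting ((λ ()) ∘ σ-inj)
  preserves 2F 0F ()
  preserves 2F 1F _ = attX-eventOmitting ((λ ()) ∘ σ-inj)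

wedgeInX-injInduced : ∀ σ (σ-inj : Injective _≡_ _≡_ σ) → InjInduced (wedgeInX σ σ-inj)
wedgeInX-injInduced σ σ-inj = σ-inj , events-inj , reflects
  where
  events-inj : Injective _≡_ _≡_ (wedgeEvents σ)
  events-inj {0F} {0F} _ = refl
  events-inj {0F} {1F} e = contradiction (σ-inj (eventOmitting-injective e)) λ ()
  events-inj {1F} {0F} e = contradiction (σ-inj (eventOmitting-injective e)) λ ()
  events-inj {1F} {1F} _ = refl

  reflects : ∀ a e → T (attX (σ a) (wedgeEvents σ e)) → T (attW a e)
  reflects 0F 0F _ = tt
  reflects 0F 1F = ¬attX-eventOmitting-self (σ 0F)
  reflects 1F 0F _ = tt
  reflects 1F 1F _ = tt
  reflects 2F 0F = ¬attX-eventOmitting-self (σ 2F)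
  reflects 2F 1F _ = tt

opposite-injective : ∀ {n} → Injective _≡_ _≡_ (opposite {n})
opposite-injective =
  inverseʳ⇒injective opposite
    (strictlyInverseʳ⇒inverseʳ {f⁻¹ = opposite} opposite opposite-involutive)

reverseW : Hom W W
reverseW = record { act = opposite ; ev = opposite ; pres = preserves }
  where
  preserves : ∀ a e → T (attW a e) → T (attW (opposite a) (opposite e))
  preserves 0F 0F _ = tt
  preserves 0F 1F ()
  preserves 1F 0F _ = tt
  preserves 1F 1F _ = tt
  preserves 2F 0F ()
  preserves 2F 1F _ = tt

reverseW-injInduced : InjInduced reverseW
reverseW-injInduced = opposite-injective , opposite-injective , reflects
  where
  reflects : ∀ a e → T (attW (opposite a) (opposite e)) → T (attW a e)
  reflects 0F 0F _ = tt
  reflects 0F 1F ()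
  reflects 1F 0F _ = tt
  reflects 1F 1F _ = tt
  reflects 2F 0F ()
  reflects 2F 1F _ = tt

WedgeAt : MorPred → Triad → Fin 3 → Fin 3 → Fin 3 → Set
WedgeAt 𝒞 K i j k = Σ (Hom W K) λ φ → 𝒞 φ × triple φ ≡ (i , j , k)

wedge-distinct : ∀ {𝒞 : MorPred} → IsSubcategory 𝒞 → ∀ {K} {φ : Hom W K} → 𝒞 φ →
                 Distinct3 (act φ 0F) (act φ 1F) (act φ 2F)
wedge-distinct sub {φ = φ} φ∈𝒞 = injective⇒distinct (IsSubcategory.inT sub φ φ∈𝒞)

module _ {𝒞 : MorPred} (sub : IsSubcategory 𝒞) (ax1 : Axiom1 𝒞) where
  open IsSubcategory sub

  reversed-wedge : ∀ {K} {φ : Hom W K} → 𝒞 φ → 𝒞 (φ ∘H reverseW)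
  reversed-wedge {φ = φ} φ∈𝒞 =
    compC φ reverseW φ∈𝒞 (ax1 reverseW opposite-injective reverseW-injInduced)

  alcove⇒wedgeAt-every-triple : ∀ {K} (χ : Hom X K) → 𝒞 χ →
                                ∀ i j k → Distinct3 i j k → WedgeAt 𝒞 K i j k
  alcove⇒wedgeAt-every-triple χ χ∈𝒞 i j k d
    with σ , σ-inj , χσ≗ijk ←
      injection-factors-through-injection (inT χ χ∈𝒞) (distinct⇒injective d) =
    χ ∘H wedgeInX σ σ-inj ,
    compC χ _ χ∈𝒞 (ax1 _ σ-inj (wedgeInX-injInduced σ σ-inj)) ,
    cong₂ _,_ (χσ≗ijk 0F) (cong₂ _,_ (χσ≗ijk 1F) (χσ≗ijk 2F))

module Trichotomy
  (em : ExcludedMiddle 0ℓ) (𝒞 : MorPred) (_∼_ : MorRel)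
  (sub : IsSubcategory 𝒞) (ax1 : Axiom1 𝒞) {K : Triad}
  (unique : ∀ (φ ψ : Hom W K) → 𝒞 φ → 𝒞 ψ → triple φ ≡ triple ψ → φ ∼ ψ)
  (closed : ∀ (φ ψ : Hom W K) → 𝒞 φ → 𝒞 ψ → center φ ≢ center ψ →
            Closed 𝒞 _∼_ φ × Closed 𝒞 _∼_ ψ)
  where

  same-triple⇒same-wedge : ∀ {φ ψ : Hom W K} → 𝒞 φ → 𝒞 ψ →
                           triple φ ≡ triple ψ → SameWedge _∼_ φ ψ
  same-triple⇒same-wedge {φ} {ψ} φ∈𝒞 ψ∈𝒞 e = unique φ ψ φ∈𝒞 ψ∈𝒞 e , e

  closed⇒wedgeAt-every-triple : ∀ {φ : Hom W K} → Closed 𝒞 _∼_ φ →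
                                ∀ i j k → Distinct3 i j k → WedgeAt 𝒞 K i j k
  closed⇒wedgeAt-every-triple (χ , χ∈𝒞 , _) = alcove⇒wedgeAt-every-triple sub ax1 χ χ∈𝒞

  sixClosed : (φ ψ : Hom W K) → 𝒞 φ → 𝒞 ψ → center φ ≢ center ψ →
              SixClosedWedges 𝒞 _∼_ K
  sixClosed φ ψ φ∈𝒞 ψ∈𝒞 φ≢ψ =
    closed⇒wedgeAt-every-triple (proj₁ (closed φ ψ φ∈𝒞 ψ∈𝒞 φ≢ψ)) ,
    (λ _ _ → same-triple⇒same-wedge) ,
    all-closed
    where
    all-closed : ∀ θ → 𝒞 θ → Closed 𝒞 _∼_ θ
    all-closed θ θ∈𝒞 with center θ ≟ center φ
    ... | yes θ≡φ = proj₁ (closed θ ψ θ∈𝒞 ψ∈𝒞 (φ≢ψ ∘ trans (sym θ≡φ)))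
    ... | no  θ≢φ = proj₁ (closed θ φ θ∈𝒞 φ∈𝒞 θ≢φ)

  twoOpen : (φ : Hom W K) → 𝒞 φ → (∀ ψ → 𝒞 ψ → center ψ ≡ center φ) →
            TwoOpenWedges 𝒞 _∼_ K
  twoOpen φ φ∈𝒞 centered =
    φ , φ ∘H reverseW , φ∈𝒞 , φᵒ∈𝒞 , ends-differ , covers , open-wedge , open-wedge
    where
    φᵒ∈𝒞 : 𝒞 (φ ∘H reverseW)
    φᵒ∈𝒞 = reversed-wedge sub ax1 φ∈𝒞

    d : Distinct3 (act φ 0F) (act φ 1F) (act φ 2F)
    d = wedge-distinct sub φ∈𝒞

    ends-differ : ¬ SameWedge _∼_ φ (φ ∘H reverseW)
    ends-differ (_ , e) = proj₂ (proj₂ d) (cong proj₁ e)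

    covers : ∀ ψ → 𝒞 ψ → SameWedge _∼_ ψ φ ⊎ SameWedge _∼_ ψ (φ ∘H reverseW)
    covers ψ ψ∈𝒞 =
      Sum.map (same-triple⇒same-wedge ψ∈𝒞 φ∈𝒞) (same-triple⇒same-wedge ψ∈𝒞 φᵒ∈𝒞)
        (same-center⇒same-or-reversed d (wedge-distinct sub ψ∈𝒞) (centered ψ ψ∈𝒞))

    open-wedge : ∀ {θ : Hom W K} → ¬ Closed 𝒞 _∼_ θ
    open-wedge θ-closed
      with ψ , ψ∈𝒞 , ψ-at ← closed⇒wedgeAt-every-triple θ-closed
             (act φ 1F) (act φ 0F) (act φ 2F)
             (proj₁ d ∘ sym , proj₂ (proj₂ d) , proj₁ (proj₂ d)) =
      proj₁ d (trans (sym (cong (proj₁ ∘ proj₂) ψ-at)) (centered ψ ψ∈𝒞))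

  trichotomy : NoWedges 𝒞 K ⊎ TwoOpenWedges 𝒞 _∼_ K ⊎ SixClosedWedges 𝒞 _∼_ K
  trichotomy with em {Σ (Hom W K) 𝒞}
  ... | no none = inj₁ (λ φ φ∈𝒞 → none (φ , φ∈𝒞))
  ... | yes (φ , φ∈𝒞) with em {Σ (Hom W K) λ ψ → 𝒞 ψ × center ψ ≢ center φ}
  ...   | yes (ψ , ψ∈𝒞 , ψ≢φ) = inj₂ (inj₂ (sixClosed ψ φ ψ∈𝒞 φ∈𝒞 ψ≢φ))
  ...   | no none = inj₂ (inj₁ (twoOpen φ φ∈𝒞 λ ψ ψ∈𝒞 →
                      decidable-stable (center ψ ≟ center φ) λ ψ≢φ → none (ψ , ψ∈𝒞 , ψ≢φ)))

  exactlyOne : ExactlyOneOf (NoWedges 𝒞 K) (TwoOpenWedges 𝒞 _∼_ K)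
                            (SixClosedWedges 𝒞 _∼_ K)
  exactlyOne =
    trichotomy ,
    (λ (none , (φ , _ , φ∈𝒞 , _)) → none φ φ∈𝒞) ,
    (λ (none , (wedgeAt , _)) →
       let (φ , φ∈𝒞 , _) = wedgeAt 0F 1F 2F ((λ ()) , (λ ()) , (λ ())) in none φ φ∈𝒞) ,
    (λ ((φ , _ , φ∈𝒞 , _ , _ , _ , φ-open , _) , (_ , _ , all-closed)) →
       φ-open (all-closed φ φ∈𝒞))

lemma3 : ExcludedMiddle 0ℓ →
         (𝒞 : MorPred) (_∼_ : MorRel) →
         IsSubcategory 𝒞 → IsCongruence 𝒞 _∼_ →
         Axiom1 𝒞 → Axiom3 𝒞 _∼_ → Axiom4 𝒞 _∼_ →
         (G : AN) (τ : TriadIn G) →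
         ExactlyOneOf (NoWedges 𝒞 (triad G τ))
                      (TwoOpenWedges 𝒞 _∼_ (triad G τ))
                      (SixClosedWedges 𝒞 _∼_ (triad G τ))
lemma3 em 𝒞 _∼_ sub _ ax1 ax3 ax4 G τ =
  Trichotomy.exactlyOne em 𝒞 _∼_ sub ax1 (ax3 G τ) (ax4 G τ)
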